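{- Let $k \ge 2$ be an integer, and let $G$ be a graph of even order $n$. If $\beta^k(G) \ge 1$, then $G$ has a perfect matching.
   Context: All graphs are finite and simple. For $S\subseteq V(G)$, $\Lambda^k_G(S)$ is the set of vertices with at least $k$ neighbors in $S$, and $\beta^k(G)=\min\{|\Lambda^k_G(S)|/|S| : S\subseteq V(G),\ |S|\ge k,\ \Lambda^k_G(S)\ne V(G)\}$, with $\beta^k(G)=0$ if $|V(G)|<k$. -}

module Defs where

open import Data.Nat using (ℕ; _≤_; _≤ᵇ_)
open import Data.Bool using (Bool; true; false; T)
open import Data.Fin using (Fin)
open import Data.Fin.Subset using (Subset; _∩_; ∣_∣; ⊤)
open import Data.Vec using (tabulate)
open import Data.Product using (_×_)
open import Relation.Binary.PropositionalEquality using (_≡_; _≢_)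

record Graph (n : ℕ) : Set where
  field
    adj       : Fin n → Fin n → Bool
    adj-sym   : ∀ u v → adj u v ≡ adj v u
    adj-irref : ∀ v → adj v v ≡ false
open Graph public

N : ∀ {n} → Graph n → Fin n → Subset n
N G v = tabulate (adj G v)

Λ : ∀ {n} → ℕ → Graph n → Subset n → Subset n
Λ k G S = tabulate (λ v → k ≤ᵇ ∣ N G v ∩ S ∣)

-- β^k(G) ≥ 1.
-- β^k(G) = 0 if n < k, so β^k(G) ≥ 1 forces k ≤ n. When k ≤ n the minimum
-- is over a nonempty (finite) set, and since |S| ≥ k > 0 the ratio
-- |Λ^k(S)|/|S| is ≥ 1 iff |S| ≤ |Λ^k(S)|.
β≥1 : ∀ {n} → ℕ → Graph n → Set
β≥1 {n} k G =
  (k ≤ n) × (∀ (S : Subset n) → k ≤ ∣ S ∣ → Λ k G S ≢ ⊤ → ∣ S ∣ ≤ ∣ Λ k G S ∣)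

record PerfectMatching {n} (G : Graph n) : Set where
  field
    mate       : Fin n → Fin n
    mate-invol : ∀ v → mate (mate v) ≡ v
    mate-adj   : ∀ v → T (adj G v (mate v))

{-# OPTIONS --safe #-}
module Submission where

-- Adding edges preserves β^k(G) ≥ 1, so we induct on the number of non-edges.  If some vertex b has a
-- non-neighbour d and two non-adjacent neighbours a, c, then G + ac and G + bd have perfect matchings M₁
-- and M₂; unless one of them avoids its new edge, M₁ ∋ ac and M₂ ∋ bd, and following the M₁/M₂-alternating
-- walk from d until it first meets {a, b, c} and switching along it (adding the edge b–a or b–c if the
-- walk stays open) yields a perfect matching of G.  Otherwise every non-universal vertex has a clique as
-- neighbourhood.  Let X be the set of universal vertices.  For an independent set S of non-universal
-- vertices, Λ^k(S) ⊆ X as k ≥ 2, so β^k ≥ 1 gives |S| ≤ |X| when |S| ≥ k; when |S| < k, a k-set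
-- containing a non-universal vertex and one of its non-neighbours shows k ≤ |X|.  A greedy pairing (two
-- adjacent non-universal vertices, else a non-universal vertex with a universal one, else two universal
-- vertices) keeps "|R| is even and |S| ≤ |R ∩ X| for every such S inside the unmatched set R", and so
-- never gets stuck.

open import Defs
open import Data.Bool using (Bool; false; T; T?; _∧_; _∨_; if_then_else_)
open import Data.Bool.Properties using (T-≡; T-∨; ∨-comm)
open import Data.Empty using (⊥-elim)
open import Data.Fin using (Fin; zero; suc; toℕ; _≟_)
open import Data.Fin.Properties using (all?; any?; ¬∀⟶∃¬; suc-injective; pigeonhole)
open import Data.Fin.Subset using (Subset; inside; outside; _∈_; _∉_; _⊆_; _∩_; ∁; _-_; ⊤; ∣_∣; Nonempty)
open import Data.Fin.Subset.Properties
  using (_∈?_; ∈⊤; ⊆⊤; ⊆-antisym; nonempty?; Empty-unique; ∣⊥∣≡0; ∣⊤∣≡n; p⊆q⇒∣p∣≤∣q∣; p⊂q⇒∣p∣<∣q∣;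
         x∈p∩q⁺; x∈p∩q⁻; p∩q⊆p; p∩q⊆q; x∈∁p⇒x∉p; x∉p⇒x∈∁p; p─q⊆p; p─⊥≡p; x∈p∧x≢y⇒x∈p-y;
         x∈p⇒∣p-x∣<∣p∣)
open import Data.Nat using (ℕ; zero; suc; _+_; _∸_; _≤_; _<_; _<?_; z≤n; s≤s)
open import Data.Nat.Properties
  using (≤-refl; ≤-reflexive; ≤-trans; ≤-antisym; ≤-pred; <-trans; ≤-<-trans; <⇒≤; <⇒≢; <⇒≱; ≮⇒≥;
         n≢0⇒n>0; m≤n⇒m<n∨m≡n; ≤ᵇ⇒≤; ≤⇒≤ᵇ; +-suc; +-identityʳ; m+[n∸m]≡n; +-mono-≤; +-mono-<-≤;
         +-mono-≤-<; +-0-monoid; anyUpTo?; module ≤-Reasoning)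
open import Algebra.Properties.Monoid.Sum +-0-monoid using (sum)
open import Data.Nat.Divisibility using (_∣_; ∣-refl; ∣m+n∣m⇒∣n; >⇒∤)
open import Data.Nat.Induction using (<-wellFounded; <-rec)
open import Data.Product using (_×_; _,_; proj₁; proj₂; ∃; ∃₂; swap)
open import Data.Sum using (_⊎_; inj₁; inj₂; [_,_]′)
open import Data.Unit using (tt)
open import Data.Vec using (_∷_; tabulate)
open import Data.Vec.Base using (here; there)
open import Data.Vec.Properties using (lookup∘tabulate; []=⇒lookup; lookup⇒[]=)
open import Function using (_∘_; const; flip; Equivalence)
open import Induction.WellFounded using (Acc; acc)
open import Level using (0ℓ)
open import Relation.Binary.PropositionalEquality using (_≡_; _≢_; refl; sym; trans; cong; cong₂; subst)
open import Relation.Nullary using (¬_; Dec; yes; no; does; contradiction)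
open import Relation.Nullary.Decidable
  using (_⊎-dec_; _×-dec_; _→-dec_; ¬?; decidable-stable; ⌊_⌋; toWitness; fromWitness)
open import Relation.Unary using (Pred; Decidable; U)

private
  variable
    n k : ℕ

∈-tabulate⁺ : ∀ {f : Fin n → Bool} {x} → T (f x) → x ∈ tabulate f
∈-tabulate⁺ {f = f} {x} fx =
  lookup⇒[]= x (tabulate f) (trans (lookup∘tabulate f x) (Equivalence.to T-≡ fx))

∈-tabulate⁻ : ∀ {f : Fin n → Bool} {x} → x ∈ tabulate f → T (f x)
∈-tabulate⁻ {f = f} {x} x∈ =
  Equivalence.from T-≡ (trans (sym (lookup∘tabulate f x)) ([]=⇒lookup x∈))

x∈p-y⇒x≢y : ∀ {p : Subset n} {x y} → x ∈ p - y → x ≢ y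
x∈p-y⇒x≢y {p = _ ∷ _} {zero}  {zero}  ()
x∈p-y⇒x≢y {p = _ ∷ _} {zero}  {suc _} _ ()
x∈p-y⇒x≢y {p = _ ∷ _} {suc _} {zero}  _ ()
x∈p-y⇒x≢y {p = _ ∷ _} {suc _} {suc _} (there x∈) = x∈p-y⇒x≢y x∈ ∘ suc-injective

x∈p-y⁻ : ∀ {p : Subset n} {x y} → x ∈ p - y → x ∈ p × x ≢ y
x∈p-y⁻ {p = p} x∈ = p─q⊆p p _ x∈ , x∈p-y⇒x≢y x∈

x∈p-y-z⁻ : ∀ {p : Subset n} {x y z} → x ∈ p - y - z → x ∈ p × x ≢ y × x ≢ z
x∈p-y-z⁻ x∈ with x∈p-y⁻ x∈
... | x∈p-y , x≢z with x∈p-y⁻ x∈p-y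
...   | x∈p , x≢y = x∈p , x≢y , x≢z

x∈p-y-z⁺ : ∀ {p : Subset n} {x y z} → x ∈ p → x ≢ y → x ≢ z → x ∈ p - y - z
x∈p-y-z⁺ x∈p x≢y x≢z = x∈p∧x≢y⇒x∈p-y (x∈p∧x≢y⇒x∈p-y x∈p x≢y) x≢z

∣p∣≡1+∣p-x∣ : ∀ {p : Subset n} {x} → x ∈ p → ∣ p ∣ ≡ suc ∣ p - x ∣
∣p∣≡1+∣p-x∣ {p = inside ∷ p}  here       = cong (suc ∘ ∣_∣) (sym (p─⊥≡p p))
∣p∣≡1+∣p-x∣ {p = inside ∷ _}  (there x∈) = cong suc (∣p∣≡1+∣p-x∣ x∈)
∣p∣≡1+∣p-x∣ {p = outside ∷ _} (there x∈) = ∣p∣≡1+∣p-x∣ x∈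

∣p∣≡2+∣p-x-y∣ : ∀ {p : Subset n} {x y} → x ∈ p → y ∈ p - x → ∣ p ∣ ≡ 2 + ∣ p - x - y ∣
∣p∣≡2+∣p-x-y∣ {p = p} {x} x∈p y∈p-x =
  trans (∣p∣≡1+∣p-x∣ x∈p) (cong suc (∣p∣≡1+∣p-x∣ {p = p - x} y∈p-x))

∣p-x-y∣<∣p∣ : ∀ {p : Subset n} {x y} → x ∈ p → y ∈ p - x → ∣ p - x - y ∣ < ∣ p ∣
∣p-x-y∣<∣p∣ x∈p y∈p-x = <-trans (x∈p⇒∣p-x∣<∣p∣ y∈p-x) (x∈p⇒∣p-x∣<∣p∣ x∈p)

2∣∣p∣⇒2∣∣p-x-y∣ : ∀ {p : Subset n} {x y} → x ∈ p → y ∈ p - x → 2 ∣ ∣ p ∣ → 2 ∣ ∣ p - x - y ∣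
2∣∣p∣⇒2∣∣p-x-y∣ x∈p y∈p-x 2∣∣p∣ =
  ∣m+n∣m⇒∣n (subst (2 ∣_) (∣p∣≡2+∣p-x-y∣ x∈p y∈p-x) 2∣∣p∣) ∣-refl

0<∣p∣⇒nonempty : ∀ {p : Subset n} → 0 < ∣ p ∣ → Nonempty p
0<∣p∣⇒nonempty {n} {p} 0<∣p∣ with nonempty? p
... | yes p≢∅ = p≢∅
... | no p≡∅ =
  contradiction (trans (sym (∣⊥∣≡0 n)) (cong ∣_∣ (sym (Empty-unique p≡∅)))) (<⇒≢ 0<∣p∣)

two-elements : ∀ {p : Subset n} → 2 ≤ ∣ p ∣ → ∃₂ λ x y → x ∈ p × y ∈ p × x ≢ y
two-elements {p = p} 2≤∣p∣ with 0<∣p∣⇒nonempty (≤-trans (s≤s z≤n) 2≤∣p∣)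
... | x , x∈p with 0<∣p∣⇒nonempty {p = p - x} (≤-pred (subst (2 ≤_) (∣p∣≡1+∣p-x∣ x∈p) 2≤∣p∣))
...   | y , y∈p-x with x∈p-y⁻ {p = p} y∈p-x
...     | y∈p , y≢x = x , y , x∈p , y∈p , y≢x ∘ sym

⊆-of-size : ∀ {p : Subset n} {x y} → x ∈ p → y ∈ p → x ≢ y → 2 ≤ k → k ≤ ∣ p ∣ →
            ∃ λ q → q ⊆ p × x ∈ q × y ∈ q × ∣ q ∣ ≡ k
⊆-of-size {n} {k} {p} {x} {y} x∈p y∈p x≢y 2≤k = go p (<-wellFounded _) x∈p y∈p
  where
  go : ∀ p → Acc _<_ ∣ p ∣ → x ∈ p → y ∈ p → k ≤ ∣ p ∣ →
       ∃ λ q → q ⊆ p × x ∈ q × y ∈ q × ∣ q ∣ ≡ k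
  go p (acc smaller) x∈p y∈p k≤∣p∣ with k <? ∣ p ∣
  ... | no k≮∣p∣ = p , (λ z∈ → z∈) , x∈p , y∈p , ≤-antisym (≮⇒≥ k≮∣p∣) k≤∣p∣
  ... | yes k<∣p∣ with 0<∣p∣⇒nonempty {p = p - x - y} 0<∣p-x-y∣
    where
    0<∣p-x-y∣ : 0 < ∣ p - x - y ∣
    0<∣p-x-y∣ = ≤-pred (≤-pred (subst (3 ≤_) (∣p∣≡2+∣p-x-y∣ x∈p (x∈p∧x≢y⇒x∈p-y y∈p (x≢y ∘ sym)))
                                             (≤-trans (s≤s 2≤k) k<∣p∣)))
  ... | z , z∈p-x-y with x∈p-y-z⁻ z∈p-x-y
  ...   | z∈p , z≢x , z≢y with go (p - z) (smaller (x∈p⇒∣p-x∣<∣p∣ z∈p))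
                               (x∈p∧x≢y⇒x∈p-y x∈p (z≢x ∘ sym)) (x∈p∧x≢y⇒x∈p-y y∈p (z≢y ∘ sym))
                               (≤-pred (subst (k <_) (∣p∣≡1+∣p-x∣ z∈p) k<∣p∣))
  ...     | q , q⊆p-z , rest = q , p─q⊆p p _ ∘ q⊆p-z , rest

sum-mono-≤ : ∀ {f g : Fin n → ℕ} → (∀ i → f i ≤ g i) → sum f ≤ sum g
sum-mono-≤ {zero}  f≤g = z≤n
sum-mono-≤ {suc n} f≤g = +-mono-≤ (f≤g zero) (sum-mono-≤ (f≤g ∘ suc))

sum-mono-< : ∀ {f g : Fin n → ℕ} → (∀ i → f i ≤ g i) → ∀ j → f j < g j → sum f < sum g
sum-mono-< f≤g zero    fj<gj = +-mono-<-≤ fj<gj (sum-mono-≤ (f≤g ∘ suc))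
sum-mono-< f≤g (suc j) fj<gj = +-mono-≤-< (f≤g zero) (sum-mono-< (f≤g ∘ suc) j fj<gj)

least-witness : ∀ {P : Pred ℕ 0ℓ} → Decidable P → ∀ L → P L →
                ∃ λ J → P J × (∀ {j} → j < J → ¬ P j)
least-witness {P} P? = <-rec (λ L → P L → Least) search
  where
  Least = ∃ λ J → P J × (∀ {j} → j < J → ¬ P j)
  search : ∀ L → (∀ {K} → K < L → P K → Least) → P L → Least
  search L smaller PL with anyUpTo? P? L
  ... | yes (K , K<L , PK) = smaller K<L PK
  ... | no none-below = L , PL , λ j<L Pj → none-below (_ , j<L , Pj)

Adj : Graph n → Fin n → Fin n → Set
Adj G u v = T (adj G u v)

Adj-sym : ∀ (G : Graph n) {u v} → Adj G u v → Adj G v u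
Adj-sym G {u} {v} = subst T (adj-sym G u v)

Adj-irrefl : ∀ (G : Graph n) {u v} → Adj G u v → u ≢ v
Adj-irrefl G {u} uv refl = subst T (adj-irref G u) uv

∈N⁺ : ∀ (G : Graph n) {u v} → Adj G u v → v ∈ N G u
∈N⁺ G = ∈-tabulate⁺

∈N⁻ : ∀ (G : Graph n) {u v} → v ∈ N G u → Adj G u v
∈N⁻ G = ∈-tabulate⁻

∈Λ⁺ : ∀ k (G : Graph n) {S v} → k ≤ ∣ N G v ∩ S ∣ → v ∈ Λ k G S
∈Λ⁺ k G k≤ = ∈-tabulate⁺ (≤⇒≤ᵇ k≤)

∈Λ⁻ : ∀ k (G : Graph n) {S v} → v ∈ Λ k G S → k ≤ ∣ N G v ∩ S ∣
∈Λ⁻ k G v∈Λ = ≤ᵇ⇒≤ k _ (∈-tabulate⁻ v∈Λ)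

_⊆ᴳ_ : Graph n → Graph n → Set
G ⊆ᴳ H = ∀ {u v} → Adj G u v → Adj H u v

Λ-mono : ∀ k {G H : Graph n} → G ⊆ᴳ H → ∀ S → Λ k G S ⊆ Λ k H S
Λ-mono k {G} {H} G⊆H S v∈Λ = ∈Λ⁺ k H (≤-trans (∈Λ⁻ k G v∈Λ) (p⊆q⇒∣p∣≤∣q∣ N∩S-mono))
  where
  N∩S-mono : ∀ {v} → N G v ∩ S ⊆ N H v ∩ S
  N∩S-mono x∈ with x∈p∩q⁻ _ S x∈
  ... | x∈N , x∈S = x∈p∩q⁺ (∈N⁺ H (G⊆H (∈N⁻ G x∈N)) , x∈S)

β≥1-mono : ∀ k {G H : Graph n} → G ⊆ᴳ H → β≥1 k G → β≥1 k H
β≥1-mono k {G} {H} G⊆H (k≤n , expand) = k≤n , λ S k≤∣S∣ ΛH≢⊤ →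
  ≤-trans (expand S k≤∣S∣ (λ ΛG≡⊤ → ΛH≢⊤ (⊆-antisym ⊆⊤ (subst (_⊆ _) ΛG≡⊤ (ΛG⊆ΛH S)))))
          (p⊆q⇒∣p∣≤∣q∣ (ΛG⊆ΛH S))
  where
  ΛG⊆ΛH : ∀ S → Λ k G S ⊆ Λ k H S
  ΛG⊆ΛH = Λ-mono k {G} {H} G⊆H

record MatchingOn (G : Graph n) (D : Pred (Fin n) 0ℓ) (m : Fin n → Fin n) : Set where
  field
    closed     : ∀ {v} → D v → D (m v)
    involutive : ∀ {v} → D v → m (m v) ≡ v
    adjacent   : ∀ {v} → D v → Adj G v (m v)
open MatchingOn

MatchingOn-resp : ∀ {G : Graph n} {D D′ : Pred (Fin n) 0ℓ} {m} →
                  (∀ {v} → D v → D′ v) → (∀ {v} → D′ v → D v) →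
                  MatchingOn G D m → MatchingOn G D′ m
MatchingOn-resp D⊆D′ D′⊆D M = record
  { closed     = D⊆D′ ∘ closed M ∘ D′⊆D
  ; involutive = involutive M ∘ D′⊆D
  ; adjacent   = adjacent M ∘ D′⊆D
  }

perfectMatching : ∀ {G : Graph n} {m} → MatchingOn G U m → PerfectMatching G
perfectMatching {m = m} M = record
  { mate       = m
  ; mate-invol = λ v → involutive M {v} tt
  ; mate-adj   = λ v → adjacent M {v} tt
  }

splice : ∀ {Z : Pred (Fin n) 0ℓ} → Decidable Z → (f g : Fin n → Fin n) → Fin n → Fin n
splice Z? f g v = if does (Z? v) then f v else g v

module _ {Z : Pred (Fin n) 0ℓ} (Z? : Decidable Z) {f g : Fin n → Fin n} where

  splice-in : ∀ {v} → Z v → splice Z? f g v ≡ f v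
  splice-in {v} z with Z? v
  ... | yes _ = refl
  ... | no ¬z = contradiction z ¬z

  splice-out : ∀ {v} → ¬ Z v → splice Z? f g v ≡ g v
  splice-out {v} ¬z with Z? v
  ... | yes z = contradiction z ¬z
  ... | no _  = refl

  MatchingOn-splice : ∀ {G : Graph n} {D : Pred (Fin n) 0ℓ} →
                      MatchingOn G (λ v → D v × Z v) f → MatchingOn G (λ v → D v × ¬ Z v) g →
                      MatchingOn G D (splice Z? f g)
  MatchingOn-splice {G} {D} F H = record
    { closed = closed′ ; involutive = involutive′ ; adjacent = adjacent′ }
    where
    closed′ : ∀ {v} → D v → D (splice Z? f g v)
    closed′ {v} v∈D with Z? v
    ... | yes z = proj₁ (closed F (v∈D , z))
    ... | no ¬z = proj₁ (closed H (v∈D , ¬z))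

    involutive′ : ∀ {v} → D v → splice Z? f g (splice Z? f g v) ≡ v
    involutive′ {v} v∈D with Z? v
    ... | yes z = trans (splice-in (proj₂ (closed F (v∈D , z)))) (involutive F (v∈D , z))
    ... | no ¬z = trans (splice-out (proj₂ (closed H (v∈D , ¬z)))) (involutive H (v∈D , ¬z))

    adjacent′ : ∀ {v} → D v → Adj G v (splice Z? f g v)
    adjacent′ {v} v∈D with Z? v
    ... | yes z = adjacent F (v∈D , z)
    ... | no ¬z = adjacent H (v∈D , ¬z)

perfectMatching-splice : ∀ {G : Graph n} {Z : Pred (Fin n) 0ℓ} (Z? : Decidable Z) {f g} →
                         MatchingOn G Z f → MatchingOn G (λ v → ¬ Z v) g → PerfectMatching G
perfectMatching-splice Z? F H = perfectMatching
  (MatchingOn-splice Z? (MatchingOn-resp (tt ,_) proj₂ F) (MatchingOn-resp (tt ,_) proj₂ H))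

Endpoint : Fin n → Fin n → Pred (Fin n) 0ℓ
Endpoint u v x = x ≡ u ⊎ x ≡ v

endpoint? : ∀ (u v : Fin n) → Decidable (Endpoint u v)
endpoint? u v x = (x ≟ u) ⊎-dec (x ≟ v)

pairing : Fin n → Fin n → Fin n → Fin n
pairing u v x = if does (x ≟ u) then v else u

module _ {G : Graph n} {u v : Fin n} (uv : Adj G u v) where

  pairing-left : pairing u v u ≡ v
  pairing-left with u ≟ u
  ... | yes _   = refl
  ... | no u≢u = contradiction refl u≢u

  pairing-right : pairing u v v ≡ u
  pairing-right with v ≟ u
  ... | yes v≡u = contradiction (sym v≡u) (Adj-irrefl G uv)
  ... | no _    = refl

  MatchingOn-pairing : MatchingOn G (Endpoint u v) (pairing u v)
  MatchingOn-pairing = record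
    { closed     = λ { (inj₁ refl) → inj₂ pairing-left ; (inj₂ refl) → inj₁ pairing-right }
    ; involutive = λ { (inj₁ refl) → trans (cong (pairing u v) pairing-left) pairing-right
                     ; (inj₂ refl) → trans (cong (pairing u v) pairing-right) pairing-left }
    ; adjacent   = λ { (inj₁ refl) → subst (Adj G u) (sym pairing-left) uv
                     ; (inj₂ refl) → subst (Adj G v) (sym pairing-right) (Adj-sym G uv) }
    }

MatchingOn-extend : ∀ {G : Graph n} {R u v m} → u ∈ R → v ∈ R - u → Adj G u v →
                    MatchingOn G (_∉ R) m →
                    MatchingOn G (_∉ R - u - v) (splice (endpoint? u v) (pairing u v) m)
MatchingOn-extend {R = R} {u} {v} u∈R v∈R-u uv M =
  MatchingOn-splice (endpoint? u v)
    (MatchingOn-resp (λ x∈uv → endpoint-unmatched x∈uv , x∈uv) proj₂ (MatchingOn-pairing uv))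
    (MatchingOn-resp outside-R-u-v inside-R M)
  where
  endpoint-unmatched : ∀ {x} → Endpoint u v x → x ∉ R - u - v
  endpoint-unmatched (inj₁ refl) x∈ = proj₁ (proj₂ (x∈p-y-z⁻ x∈)) refl
  endpoint-unmatched (inj₂ refl) x∈ = proj₂ (proj₂ (x∈p-y-z⁻ x∈)) refl

  outside-R-u-v : ∀ {x} → x ∉ R → x ∉ R - u - v × ¬ Endpoint u v x
  outside-R-u-v x∉R = x∉R ∘ proj₁ ∘ x∈p-y-z⁻
                    , λ { (inj₁ refl) → x∉R u∈R ; (inj₂ refl) → x∉R (proj₁ (x∈p-y⁻ v∈R-u)) }

  inside-R : ∀ {x} → x ∉ R - u - v × ¬ Endpoint u v x → x ∉ R
  inside-R (x∉ , ¬endpoint) x∈R = x∉ (x∈p-y-z⁺ x∈R (¬endpoint ∘ inj₁) (¬endpoint ∘ inj₂))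

-- R is the set of vertices that are still unmatched.
Pairable : Graph n → Pred (Subset n) 0ℓ → Set
Pairable G P = ∀ R → P R → Nonempty R →
  ∃ λ u → u ∈ R × ∃ λ v → v ∈ R - u × Adj G u v × P (R - u - v)

pairable⇒perfectMatching : ∀ {G : Graph n} {P} → Pairable G P → P ⊤ → PerfectMatching G
pairable⇒perfectMatching {n} {G} {P} pairable P⊤ =
  perfectMatching (proj₂ (extend ⊤ (<-wellFounded _) P⊤ (λ x → x) nothing-matched))
  where
  nothing-matched : MatchingOn G (_∉ ⊤) (λ x → x)
  nothing-matched = record { closed = vacuous ; involutive = vacuous ; adjacent = vacuous }
    where
    vacuous : ∀ {A : Set} {x} → x ∉ ⊤ → A
    vacuous x∉⊤ = ⊥-elim (x∉⊤ ∈⊤)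

  extend : ∀ R → Acc _<_ ∣ R ∣ → P R → ∀ m → MatchingOn G (_∉ R) m → ∃ (MatchingOn G U)
  extend R (acc smaller) PR m M with nonempty? R
  ... | no R≡∅ = m , MatchingOn-resp (λ _ → tt) (λ {x} _ x∈R → R≡∅ (x , x∈R)) M
  ... | yes R≢∅ with pairable R PR R≢∅
  ...   | u , u∈R , v , v∈R-u , uv , PR′ =
          extend (R - u - v) (smaller (∣p-x-y∣<∣p∣ u∈R v∈R-u)) PR′ _ (MatchingOn-extend u∈R v∈R-u uv M)

module _ {G : Graph n} (M : PerfectMatching G) where
  open PerfectMatching M

  mate-≢ : ∀ v → mate v ≢ v
  mate-≢ v mate-v≡v = Adj-irrefl G (mate-adj v) (sym mate-v≡v)

  mate-injective : ∀ {u v} → mate u ≡ mate v → u ≡ v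
  mate-injective {u} {v} eq = trans (sym (mate-invol u)) (trans (cong mate eq) (mate-invol v))

  mate-swap : ∀ {u v} → mate u ≡ v → u ≡ mate v
  mate-swap {u} eq = trans (sym (mate-invol u)) (cong mate eq)

joins : Fin n → Fin n → Fin n → Fin n → Bool
joins a c u v = ⌊ u ≟ a ⌋ ∧ ⌊ v ≟ c ⌋

joins⁻ : ∀ {a c u v : Fin n} → T (joins a c u v) → u ≡ a × v ≡ c
joins⁻ {a = a} {c} {u} {v} _ with u ≟ a | v ≟ c
... | yes u≡a | yes v≡c = u≡a , v≡c

joins-refl : ∀ (a c : Fin n) → T (joins a c a c)
joins-refl a c with a ≟ a | c ≟ c
... | yes _  | yes _  = _
... | no a≢a | _      = contradiction refl a≢a
... | yes _  | no c≢c = contradiction refl c≢c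

¬joins-loop : ∀ {a c} → a ≢ c → ∀ (v : Fin n) → joins a c v v ≡ false
¬joins-loop {a = a} {c} a≢c v with v ≟ a | v ≟ c
... | yes refl | yes refl = contradiction refl a≢c
... | yes _    | no _     = refl
... | no _     | _        = refl

addEdge : (G : Graph n) (a c : Fin n) → a ≢ c → Graph n
addEdge G a c a≢c = record
  { adj       = λ u v → adj G u v ∨ (joins a c u v ∨ joins a c v u)
  ; adj-sym   = λ u v → cong₂ _∨_ (adj-sym G u v) (∨-comm (joins a c u v) (joins a c v u))
  ; adj-irref = λ v → cong₂ _∨_ (adj-irref G v) (cong₂ _∨_ (¬joins-loop a≢c v) (¬joins-loop a≢c v))
  }

module _ (G : Graph n) {a c : Fin n} (a≢c : a ≢ c) where

  ⊆ᴳ-addEdge : G ⊆ᴳ addEdge G a c a≢c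
  ⊆ᴳ-addEdge uv = Equivalence.from T-∨ (inj₁ uv)

  addEdge-joins : Adj (addEdge G a c a≢c) a c
  addEdge-joins = Equivalence.from (T-∨ {adj G a c}) (inj₂ (Equivalence.from T-∨ (inj₁ (joins-refl a c))))

  addEdge⁻ : ∀ {u v} → Adj (addEdge G a c a≢c) u v →
             Adj G u v ⊎ (u ≡ a × v ≡ c) ⊎ (u ≡ c × v ≡ a)
  addEdge⁻ {u} {v} uv with Equivalence.to (T-∨ {adj G u v}) uv
  ... | inj₁ uv∈G = inj₁ uv∈G
  ... | inj₂ joined with Equivalence.to (T-∨ {joins a c u v}) joined
  ...   | inj₁ u,v≡a,c = inj₂ (inj₁ (joins⁻ u,v≡a,c))
  ...   | inj₂ v,u≡a,c = inj₂ (inj₂ (swap (joins⁻ v,u≡a,c)))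

  module _ (M : PerfectMatching (addEdge G a c a≢c)) where
    open PerfectMatching M

    mate-adj-off : ∀ {v} → v ≢ a → v ≢ c → Adj G v (mate v)
    mate-adj-off {v} v≢a v≢c with addEdge⁻ (mate-adj v)
    ... | inj₁ adjacent-in-G    = adjacent-in-G
    ... | inj₂ (inj₁ (v≡a , _)) = contradiction v≡a v≢a
    ... | inj₂ (inj₂ (v≡c , _)) = contradiction v≡c v≢c

    addEdge-unused : mate a ≢ c → PerfectMatching G
    addEdge-unused mate-a≢c = record { mate = mate ; mate-invol = mate-invol ; mate-adj = adjacent-in-G }
      where
      adjacent-in-G : ∀ v → Adj G v (mate v)
      adjacent-in-G v with addEdge⁻ (mate-adj v)
      ... | inj₁ adjacent                 = adjacent
      ... | inj₂ (inj₁ (refl , mate-a≡c)) = contradiction mate-a≡c mate-a≢c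
      ... | inj₂ (inj₂ (refl , mate-c≡a)) = contradiction (sym (mate-swap M mate-c≡a)) mate-a≢c

nonEdges : Graph n → ℕ
nonEdges G = sum (λ v → ∣ ∁ (N G v) ∣)

nonEdges-addEdge : ∀ (G : Graph n) {a c} (a≢c : a ≢ c) → ¬ Adj G a c →
                   nonEdges (addEdge G a c a≢c) < nonEdges G
nonEdges-addEdge G {a} {c} a≢c ¬ac =
  sum-mono-< (λ v → p⊆q⇒∣p∣≤∣q∣ non-nbhd-shrinks) a
    (p⊂q⇒∣p∣<∣q∣ (non-nbhd-shrinks , c , x∉p⇒x∈∁p (¬ac ∘ ∈N⁻ G) ,
                  λ c∈ → x∈∁p⇒x∉p c∈ (∈N⁺ H (addEdge-joins G a≢c))))
  where
  H = addEdge G a c a≢c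
  non-nbhd-shrinks : ∀ {v} → ∁ (N H v) ⊆ ∁ (N G v)
  non-nbhd-shrinks x∈ = x∉p⇒x∈∁p (x∈∁p⇒x∉p x∈ ∘ ∈N⁺ H ∘ ⊆ᴳ-addEdge G a≢c ∘ ∈N⁻ G)

module Switching {G : Graph n} {a b c d : Fin n} (ab : Adj G a b) (bc : Adj G b c) (¬bd : ¬ Adj G b d)
                 {a≢c : a ≢ c} {b≢d : b ≢ d}
                 (M₁ : PerfectMatching (addEdge G a c a≢c)) (M₂ : PerfectMatching (addEdge G b d b≢d))
                 (m₁a≡c : PerfectMatching.mate M₁ a ≡ c) (m₂b≡d : PerfectMatching.mate M₂ b ≡ d) where

  open PerfectMatching M₁ using () renaming (mate to m₁; mate-invol to m₁-invol)
  open PerfectMatching M₂ using () renaming (mate to m₂; mate-invol to m₂-invol)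

  m₂d≡b : m₂ d ≡ b
  m₂d≡b = sym (mate-swap M₂ m₂b≡d)

  Hit : Pred (Fin n) 0ℓ
  Hit v = v ≡ a ⊎ v ≡ b ⊎ v ≡ c

  hit? : Decidable Hit
  hit? v = (v ≟ a) ⊎-dec (v ≟ b) ⊎-dec (v ≟ c)

  d-unhit : ¬ Hit d
  d-unhit (inj₁ refl)        = ¬bd (Adj-sym G ab)
  d-unhit (inj₂ (inj₁ refl)) = b≢d refl
  d-unhit (inj₂ (inj₂ refl)) = ¬bd bc

  -- Even and odd positions of the alternating walk starting at d.
  e o : ℕ → Fin n
  e zero    = d
  e (suc j) = m₂ (o j)
  o j = m₁ (e j)

  e-unshift : ∀ i m → e i ≡ e (i + m) → d ≡ e m
  e-unshift zero    m eq = eq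
  e-unshift (suc i) m eq = e-unshift i m (mate-injective M₁ (mate-injective M₂ eq))

  reaches-b : ∃ λ L → o L ≡ b
  reaches-b with pigeonhole (≤-refl {suc n}) (λ i → e (toℕ i))
  ... | i , j , i<j , eᵢ≡eⱼ = L , trans (mate-swap M₂ (sym d≡e[1+L])) m₂d≡b
    where
    L = toℕ j ∸ suc (toℕ i)
    d≡e[1+L] : d ≡ e (suc L)
    d≡e[1+L] = e-unshift (toℕ i) (suc L)
                 (trans eᵢ≡eⱼ (cong e (sym (trans (+-suc (toℕ i) L) (m+[n∸m]≡n i<j)))))

  Q : Pred ℕ 0ℓ
  Q j = Hit (o j) ⊎ Hit (e (suc j))

  Q? : Decidable Q
  Q? j = hit? (o j) ⊎-dec hit? (e (suc j))

  first-hit : ∃ λ J → Q J × (∀ {j} → j < J → ¬ Q j)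
  first-hit = least-witness Q? (proj₁ reaches-b) (inj₁ (inj₂ (inj₁ (proj₂ reaches-b))))

  module FirstHit (J : ℕ) (before-J : ∀ {j} → j < J → ¬ Q j) where

    e-unhit : ∀ {j} → j ≤ J → ¬ Hit (e j)
    e-unhit {zero}  _   = d-unhit
    e-unhit {suc j} j<J = before-J j<J ∘ inj₂

    o-unhit : ∀ {j} → j < J → ¬ Hit (o j)
    o-unhit j<J = before-J j<J ∘ inj₁

    -- Reading the walk backwards from o (j + g) = e j would force m₁ or m₂ to fix a vertex.
    o≢e : ∀ g j → o (j + g) ≢ e j
    o≢e zero          j eq rewrite +-identityʳ j = mate-≢ M₁ (e j) eq
    o≢e (suc zero)    j eq rewrite +-suc j 0 | +-identityʳ j = mate-≢ M₂ (o j) (mate-swap M₁ eq)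
    o≢e (suc (suc g)) j eq rewrite +-suc j (suc g) | +-suc j g =
      o≢e g (suc j) (mate-swap M₂ (mate-swap M₁ eq))

    InZ : Pred (Fin n) 0ℓ
    InZ v = ∃ λ j → j < suc J × (v ≡ e j ⊎ v ≡ o j)

    InZ? : Decidable InZ
    InZ? v = anyUpTo? (λ j → (v ≟ e j) ⊎-dec (v ≟ o j)) (suc J)

    d∈Z : InZ d
    d∈Z = 0 , s≤s z≤n , inj₁ refl

    oJ∈Z : InZ (o J)
    oJ∈Z = J , ≤-refl , inj₂ refl

    Z-m₁ : ∀ {v} → InZ v → InZ (m₁ v)
    Z-m₁ (j , j<1+J , inj₁ refl) = j , j<1+J , inj₂ refl
    Z-m₁ (j , j<1+J , inj₂ refl) = j , j<1+J , inj₁ (m₁-invol (e j))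

    Z-m₂⁻ : ∀ {v} → InZ (m₂ v) → v ≡ b ⊎ v ≡ e (suc J) ⊎ InZ v
    Z-m₂⁻ (zero , _ , inj₁ m₂v≡d) = inj₁ (trans (mate-swap M₂ m₂v≡d) m₂d≡b)
    Z-m₂⁻ (suc j , s≤s j<J , inj₁ m₂v≡e[1+j]) =
      inj₂ (inj₂ (j , <⇒≤ (s≤s j<J) , inj₂ (mate-injective M₂ m₂v≡e[1+j])))
    Z-m₂⁻ (j , s≤s j≤J , inj₂ m₂v≡oj) with m≤n⇒m<n∨m≡n j≤J
    ... | inj₁ j<J  = inj₂ (inj₂ (suc j , s≤s j<J , inj₁ (mate-swap M₂ m₂v≡oj)))
    ... | inj₂ refl = inj₂ (inj₁ (mate-swap M₂ m₂v≡oj))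

    Z-unhit : ∀ {v} → InZ v → v ≡ o J ⊎ ¬ Hit v
    Z-unhit (j , s≤s j≤J , inj₁ refl) = inj₂ (e-unhit j≤J)
    Z-unhit (j , s≤s j≤J , inj₂ refl) with m≤n⇒m<n∨m≡n j≤J
    ... | inj₁ j<J  = inj₂ (o-unhit j<J)
    ... | inj₂ refl = inj₁ refl

    m₁-on-Z : (∀ {v} → InZ v → ¬ Hit v ⊎ v ≡ b) → MatchingOn G InZ m₁
    m₁-on-Z avoids = record
      { closed     = Z-m₁
      ; involutive = λ {v} _ → m₁-invol v
      ; adjacent   = λ z → mate-adj-off G a≢c M₁ (≢a z) (≢c z)
      }
      where
      ≢a : ∀ {v} → InZ v → v ≢ a
      ≢a z v≡a with avoids z
      ... | inj₁ unhit = unhit (inj₁ v≡a)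
      ... | inj₂ v≡b   = Adj-irrefl G ab (trans (sym v≡a) v≡b)

      ≢c : ∀ {v} → InZ v → v ≢ c
      ≢c z v≡c with avoids z
      ... | inj₁ unhit = unhit (inj₂ (inj₂ v≡c))
      ... | inj₂ v≡b   = Adj-irrefl G bc (trans (sym v≡b) v≡c)

    closed-cycle : o J ≡ b → PerfectMatching G
    closed-cycle oJ≡b = perfectMatching-splice InZ? (m₁-on-Z avoids) m₂-off-Z
      where
      avoids : ∀ {v} → InZ v → ¬ Hit v ⊎ v ≡ b
      avoids z with Z-unhit z
      ... | inj₁ v≡oJ  = inj₂ (trans v≡oJ oJ≡b)
      ... | inj₂ unhit = inj₁ unhit

      b∈Z : InZ b
      b∈Z = subst InZ oJ≡b oJ∈Z

      e[1+J]∈Z : InZ (e (suc J))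
      e[1+J]∈Z = subst InZ (sym (trans (cong m₂ oJ≡b) m₂b≡d)) d∈Z

      m₂-off-Z : MatchingOn G (λ v → ¬ InZ v) m₂
      m₂-off-Z = record
        { closed     = λ {v} v∉Z m₂v∈Z →
                         [ (λ { refl → v∉Z b∈Z }) , [ (λ { refl → v∉Z e[1+J]∈Z }) , v∉Z ]′ ]′ (Z-m₂⁻ m₂v∈Z)
        ; involutive = λ {v} _ → m₂-invol v
        ; adjacent   = λ v∉Z → mate-adj-off G b≢d M₂ (λ { refl → v∉Z b∈Z }) (λ { refl → v∉Z d∈Z })
        }

    open-path : ¬ Hit (o J) → ∀ {w} → e (suc J) ≡ w → w ≡ a ⊎ w ≡ c → PerfectMatching G
    open-path oJ-unhit {w} e[1+J]≡w w≡a⊎c =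
      perfectMatching-splice InZ? (m₁-on-Z (inj₁ ∘ unhit))
        (MatchingOn-splice (endpoint? b w)
          (MatchingOn-resp (λ bw∋v → endpoint∉Z bw∋v , bw∋v) proj₂ (MatchingOn-pairing bw))
          m₂-off-Z)
      where
      unhit : ∀ {v} → InZ v → ¬ Hit v
      unhit z with Z-unhit z
      ... | inj₁ refl    = oJ-unhit
      ... | inj₂ v-unhit = v-unhit

      bw : Adj G b w
      bw = [ (λ { refl → Adj-sym G ab }) , (λ { refl → bc }) ]′ w≡a⊎c

      endpoint∉Z : ∀ {v} → Endpoint b w v → ¬ InZ v
      endpoint∉Z (inj₁ refl) z = unhit z (inj₂ (inj₁ refl))
      endpoint∉Z (inj₂ refl) z = unhit z ([ inj₁ , inj₂ ∘ inj₂ ]′ w≡a⊎c)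

      m₂-off-Z : MatchingOn G (λ v → ¬ InZ v × ¬ Endpoint b w v) m₂
      m₂-off-Z = record
        { closed     = λ (v∉Z , ¬bw∋v) →
            (λ m₂v∈Z → [ ¬bw∋v ∘ inj₁ , [ ¬bw∋v ∘ inj₂ ∘ flip trans e[1+J]≡w , v∉Z ]′ ]′ (Z-m₂⁻ m₂v∈Z))
          , [ (λ m₂v≡b → v∉Z (subst InZ (sym (trans (mate-swap M₂ m₂v≡b) m₂b≡d)) d∈Z))
            , (λ m₂v≡w → v∉Z (subst InZ (sym (mate-injective M₂ (trans m₂v≡w (sym e[1+J]≡w)))) oJ∈Z)) ]′
        ; involutive = λ {v} _ → m₂-invol v
        ; adjacent   = λ (v∉Z , ¬bw∋v) → mate-adj-off G b≢d M₂ (¬bw∋v ∘ inj₁) (λ { refl → v∉Z d∈Z })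
        }

    hit-at-o : Hit (o J) → PerfectMatching G
    hit-at-o (inj₁ oJ≡a)        =
      contradiction (inj₂ (inj₂ (trans (mate-swap M₁ oJ≡a) m₁a≡c))) (e-unhit ≤-refl)
    hit-at-o (inj₂ (inj₁ oJ≡b)) = closed-cycle oJ≡b
    hit-at-o (inj₂ (inj₂ oJ≡c)) =
      contradiction (inj₁ (trans (mate-swap M₁ oJ≡c) (sym (mate-swap M₁ m₁a≡c)))) (e-unhit ≤-refl)

    at-first-hit : Q J → PerfectMatching G
    at-first-hit (inj₁ oJ-hit) = hit-at-o oJ-hit
    at-first-hit (inj₂ e[1+J]-hit) with hit? (o J)
    ... | yes oJ-hit  = hit-at-o oJ-hit
    ... | no oJ-unhit with e[1+J]-hit
    ...   | inj₁ e[1+J]≡a        = open-path oJ-unhit e[1+J]≡a (inj₁ refl)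
    ...   | inj₂ (inj₂ e[1+J]≡c) = open-path oJ-unhit e[1+J]≡c (inj₂ refl)
    ...   | inj₂ (inj₁ e[1+J]≡b) = contradiction (trans (mate-swap M₂ e[1+J]≡b) m₂b≡d) (o≢e J 0)

  switch : PerfectMatching G
  switch with first-hit
  ... | J , QJ , before-J = FirstHit.at-first-hit J before-J QJ

perfectMatching-switch : ∀ {G : Graph n} {a b c d} → Adj G a b → Adj G b c → ¬ Adj G b d →
                         (a≢c : a ≢ c) (b≢d : b ≢ d) →
                         PerfectMatching (addEdge G a c a≢c) → PerfectMatching (addEdge G b d b≢d) →
                         PerfectMatching G
perfectMatching-switch {G = G} {a} {b} {c} {d} ab bc ¬bd a≢c b≢d M₁ M₂
  with PerfectMatching.mate M₁ a ≟ c | PerfectMatching.mate M₂ b ≟ d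
... | no m₁a≢c  | _         = addEdge-unused G a≢c M₁ m₁a≢c
... | yes _     | no m₂b≢d  = addEdge-unused G b≢d M₂ m₂b≢d
... | yes m₁a≡c | yes m₂b≡d = Switching.switch ab bc ¬bd M₁ M₂ m₁a≡c m₂b≡d

Universal : Graph n → Pred (Fin n) 0ℓ
Universal G v = ∀ w → w ≢ v → Adj G v w

universal? : ∀ (G : Graph n) → Decidable (Universal G)
universal? G v = all? (λ w → ¬? (w ≟ v) →-dec T? (adj G v w))

¬universal⇒non-neighbour : ∀ {G : Graph n} {v} → ¬ Universal G v → ∃ λ w → w ≢ v × ¬ Adj G v w
¬universal⇒non-neighbour {G = G} {v} ¬univ
  with ¬∀⟶∃¬ _ _ (λ w → ¬? (w ≟ v) →-dec T? (adj G v w)) ¬univ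
... | w , ¬[w≢v→vw] = w , (λ w≡v → ¬[w≢v→vw] (λ w≢v → contradiction w≡v w≢v)) , ¬[w≢v→vw] ∘ const

CliqueNbhds : Graph n → Set
CliqueNbhds G = ∀ {u v w} → ¬ Universal G v → Adj G v u → Adj G v w → u ≢ w → Adj G u w

record Obstruction (G : Graph n) : Set where
  constructor obstruction
  field
    {a b c d} : Fin n
    ab  : Adj G a b
    bc  : Adj G b c
    a≢c : a ≢ c
    ¬ac : ¬ Adj G a c
    b≢d : b ≢ d
    ¬bd : ¬ Adj G b d

cliqueNbhds-or-obstruction : ∀ (G : Graph n) → CliqueNbhds G ⊎ Obstruction G
cliqueNbhds-or-obstruction G with any? (λ v → any? (λ u → any? (λ w →
  ¬? (universal? G v) ×-dec T? (adj G v u) ×-dec T? (adj G v w) ×-dec ¬? (u ≟ w) ×-dec ¬? (T? (adj G u w)))))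
... | yes (v , u , w , ¬univ , vu , vw , u≢w , ¬uw) with ¬universal⇒non-neighbour {G = G} ¬univ
...   | d , d≢v , ¬vd = inj₂ (obstruction (Adj-sym G vu) vw u≢w ¬uw (d≢v ∘ sym) ¬vd)
cliqueNbhds-or-obstruction G | no none = inj₁ λ {u} {v} {w} ¬univ vu vw u≢w →
  decidable-stable (T? (adj G u w)) (λ ¬uw → none (v , u , w , ¬univ , vu , vw , u≢w , ¬uw))

perfectMatching-by-saturation : ∀ {P : Pred (Graph n) 0ℓ} → (∀ {G H} → G ⊆ᴳ H → P G → P H) →
                                (∀ {G} → P G → CliqueNbhds G → PerfectMatching G) →
                                ∀ {G} → P G → PerfectMatching G
perfectMatching-by-saturation {n} {P} P-mono saturated {G} = go G (<-wellFounded (nonEdges G))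
  where
  go : ∀ G → Acc _<_ (nonEdges G) → P G → PerfectMatching G
  go G (acc smaller) PG with cliqueNbhds-or-obstruction G
  ... | inj₁ cliques = saturated PG cliques
  ... | inj₂ (obstruction ab bc a≢c ¬ac b≢d ¬bd) =
        perfectMatching-switch ab bc ¬bd a≢c b≢d (go-addEdge a≢c ¬ac) (go-addEdge b≢d ¬bd)
    where
    go-addEdge : ∀ {x y} (x≢y : x ≢ y) → ¬ Adj G x y → PerfectMatching (addEdge G x y x≢y)
    go-addEdge x≢y ¬xy = go _ (smaller (nonEdges-addEdge G x≢y ¬xy)) (P-mono (⊆ᴳ-addEdge G x≢y) PG)

module Saturated {G : Graph n} (2≤k : 2 ≤ k) (2∣n : 2 ∣ n) (β : β≥1 k G) (cliques : CliqueNbhds G) where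

  X : Subset n
  X = tabulate (λ v → ⌊ universal? G v ⌋)

  X⁺ : ∀ {v} → Universal G v → v ∈ X
  X⁺ univ = ∈-tabulate⁺ (fromWitness univ)

  X⁻ : ∀ {v} → v ∈ X → Universal G v
  X⁻ v∈X = toWitness (∈-tabulate⁻ v∈X)

  X-adj : ∀ {x y} → x ∈ X → y ≢ x → Adj G x y
  X-adj x∈X y≢x = X⁻ x∈X _ y≢x

  clique : ∀ {u v w} → v ∉ X → Adj G v u → Adj G v w → u ≢ w → Adj G u w
  clique v∉X = cliques (v∉X ∘ X⁺)

  record NonUniversalIndependent (S : Subset n) : Set where
    field
      non-universal : ∀ {x} → x ∈ S → x ∉ X
      independent   : ∀ {x y} → x ∈ S → y ∈ S → ¬ Adj G x y
  open NonUniversalIndependent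

  Λ⊆X : ∀ {S} → NonUniversalIndependent S → Λ k G S ⊆ X
  Λ⊆X {S} I {v} v∈Λ with v ∈? X
  ... | yes v∈X = v∈X
  ... | no v∉X with two-elements (≤-trans 2≤k (∈Λ⁻ k G v∈Λ))
  ...   | s , t , s∈ , t∈ , s≢t with x∈p∩q⁻ (N G v) S s∈ | x∈p∩q⁻ (N G v) S t∈
  ...     | s∈N , s∈S | t∈N , t∈S =
    contradiction (clique v∉X (∈N⁻ G s∈N) (∈N⁻ G t∈N) s≢t) (independent I s∈S t∈S)

  k≤∣X∣ : ∀ {v} → v ∉ X → k ≤ ∣ X ∣
  k≤∣X∣ {v} v∉X with ¬universal⇒non-neighbour {G = G} (v∉X ∘ X⁺)
  ... | w , w≢v , ¬vw with ⊆-of-size ∈⊤ ∈⊤ (w≢v ∘ sym) 2≤k (subst (k ≤_) (sym (∣⊤∣≡n n)) (proj₁ β))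
  ...   | T , _ , v∈T , w∈T , ∣T∣≡k = begin
    k            ≡⟨ sym ∣T∣≡k ⟩
    ∣ T ∣        ≤⟨ proj₂ β T (≤-reflexive (sym ∣T∣≡k)) ΛT≢⊤ ⟩
    ∣ Λ k G T ∣  ≤⟨ p⊆q⇒∣p∣≤∣q∣ ΛT⊆X ⟩
    ∣ X ∣        ∎
    where
    open ≤-Reasoning
    ΛT⊆X : Λ k G T ⊆ X
    ΛT⊆X {u} u∈Λ with u ∈? X
    ... | yes u∈X = u∈X
    ... | no u∉X = contradiction (∈Λ⁻ k G u∈Λ) (<⇒≱ (subst (∣ N G u ∩ T ∣ <_) ∣T∣≡k ∣N∩T∣<∣T∣))
      where
      misses : ∀ {t} → t ∈ T → ¬ Adj G u t → ∣ N G u ∩ T ∣ < ∣ T ∣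
      misses t∈T ¬ut = p⊂q⇒∣p∣<∣q∣ (p∩q⊆q _ _ , _ , t∈T , ¬ut ∘ ∈N⁻ G ∘ proj₁ ∘ x∈p∩q⁻ _ _)

      ∣N∩T∣<∣T∣ : ∣ N G u ∩ T ∣ < ∣ T ∣
      ∣N∩T∣<∣T∣ with T? (adj G u v) | T? (adj G u w)
      ... | yes uv | yes uw = contradiction (clique u∉X uv uw (w≢v ∘ sym)) ¬vw
      ... | no ¬uv | _      = misses v∈T ¬uv
      ... | yes _  | no ¬uw = misses w∈T ¬uw

    ΛT≢⊤ : Λ k G T ≢ ⊤
    ΛT≢⊤ Λ≡⊤ = v∉X (ΛT⊆X (subst (v ∈_) (sym Λ≡⊤) ∈⊤))

  ∣S∣≤∣X∣ : ∀ {S} → NonUniversalIndependent S → ∣ S ∣ ≤ ∣ X ∣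
  ∣S∣≤∣X∣ {S} I with nonempty? S
  ... | no S≡∅ = p⊆q⇒∣p∣≤∣q∣ {q = X} (λ x∈S → contradiction (_ , x∈S) S≡∅)
  ... | yes (s , s∈S) with ∣ S ∣ <? k
  ...   | yes ∣S∣<k = ≤-trans (<⇒≤ ∣S∣<k) (k≤∣X∣ (non-universal I s∈S))
  ...   | no ∣S∣≮k = ≤-trans (proj₂ β S (≮⇒≥ ∣S∣≮k) ΛS≢⊤) (p⊆q⇒∣p∣≤∣q∣ (Λ⊆X I))
    where
    ΛS≢⊤ : Λ k G S ≢ ⊤
    ΛS≢⊤ Λ≡⊤ = non-universal I s∈S (Λ⊆X I (subst (s ∈_) (sym Λ≡⊤) ∈⊤))

  Balanced : Pred (Subset n) 0ℓ
  Balanced R = 2 ∣ ∣ R ∣ × (∀ {S} → S ⊆ R → NonUniversalIndependent S → ∣ S ∣ ≤ ∣ R ∩ X ∣)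

  balanced-⊤ : Balanced ⊤
  balanced-⊤ = subst (2 ∣_) (sym (∣⊤∣≡n n)) 2∣n
             , λ _ I → ≤-trans (∣S∣≤∣X∣ I) (p⊆q⇒∣p∣≤∣q∣ {p = X} (λ x∈X → x∈p∩q⁺ (∈⊤ , x∈X)))

  pair-non-universal : ∀ {R u v} → u ∈ R → v ∈ R - u → u ∉ X → v ∉ X → Balanced R →
                       Balanced (R - u - v)
  pair-non-universal {R} {u} {v} u∈R v∈R-u u∉X v∉X (2∣∣R∣ , bound) =
    2∣∣p∣⇒2∣∣p-x-y∣ u∈R v∈R-u 2∣∣R∣ ,
    λ S⊆ I → ≤-trans (bound (proj₁ ∘ x∈p-y-z⁻ ∘ S⊆) I) (p⊆q⇒∣p∣≤∣q∣ R∩X⊆)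
    where
    R∩X⊆ : R ∩ X ⊆ (R - u - v) ∩ X
    R∩X⊆ x∈ with x∈p∩q⁻ R X x∈
    ... | x∈R , x∈X = x∈p∩q⁺ (x∈p-y-z⁺ x∈R (λ { refl → u∉X x∈X }) (λ { refl → v∉X x∈X }) , x∈X)

  universal-partner : ∀ {R u} → NonUniversalIndependent (R ∩ ∁ X) → u ∈ R → u ∉ X → Balanced R →
                      Nonempty (R ∩ X)
  universal-partner {R} {u} I u∈R u∉X (_ , bound) = 0<∣p∣⇒nonempty {p = R ∩ X}
    (≤-trans (≤-<-trans z≤n (x∈p⇒∣p-x∣<∣p∣ (x∈p∩q⁺ (u∈R , x∉p⇒x∈∁p u∉X)))) (bound (p∩q⊆p _ _) I))

  pair-with-universal : ∀ {R u} → NonUniversalIndependent (R ∩ ∁ X) → u ∈ R → u ∉ X → Balanced R →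
                        ∃ λ x → x ∈ R - u × Adj G u x × Balanced (R - u - x)
  pair-with-universal {R} {u} I u∈R u∉X (2∣∣R∣ , bound) with universal-partner I u∈R u∉X (2∣∣R∣ , bound)
  ... | x , x∈R∩X with x∈p∩q⁻ R X x∈R∩X
  ...   | x∈R , x∈X = x , x∈R-u , Adj-sym G (X-adj x∈X (≢u x∈X ∘ sym)) , 2∣∣p∣⇒2∣∣p-x-y∣ u∈R x∈R-u 2∣∣R∣
                    , bound′
    where
    ≢u : ∀ {y} → y ∈ X → y ≢ u
    ≢u y∈X refl = u∉X y∈X

    x∈R-u : x ∈ R - u
    x∈R-u = x∈p∧x≢y⇒x∈p-y x∈R (≢u x∈X)

    shift : (R ∩ X) - x ⊆ (R - u - x) ∩ X
    shift y∈ with x∈p-y⁻ {p = R ∩ X} y∈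
    ... | y∈R∩X , y≢x with x∈p∩q⁻ R X y∈R∩X
    ...   | y∈R , y∈X = x∈p∩q⁺ (x∈p-y-z⁺ y∈R (≢u y∈X) y≢x , y∈X)

    bound′ : ∀ {S} → S ⊆ R - u - x → NonUniversalIndependent S → ∣ S ∣ ≤ ∣ (R - u - x) ∩ X ∣
    bound′ {S} S⊆ J = ≤-pred (begin
      suc ∣ S ∣                 ≤⟨ p⊂q⇒∣p∣<∣q∣ (S⊆R∖X , u , x∈p∩q⁺ (u∈R , x∉p⇒x∈∁p u∉X) , u∉S) ⟩
      ∣ R ∩ ∁ X ∣               ≤⟨ bound (p∩q⊆p _ _) I ⟩
      ∣ R ∩ X ∣                 ≡⟨ ∣p∣≡1+∣p-x∣ x∈R∩X ⟩
      suc ∣ (R ∩ X) - x ∣       ≤⟨ s≤s (p⊆q⇒∣p∣≤∣q∣ shift) ⟩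
      suc ∣ (R - u - x) ∩ X ∣   ∎)
      where
      open ≤-Reasoning
      S⊆R∖X : S ⊆ R ∩ ∁ X
      S⊆R∖X s∈S = x∈p∩q⁺ (proj₁ (x∈p-y-z⁻ (S⊆ s∈S)) , x∉p⇒x∈∁p (non-universal J s∈S))

      u∉S : u ∉ S
      u∉S u∈S = proj₁ (proj₂ (x∈p-y-z⁻ (S⊆ u∈S))) refl

  pair-universal : ∀ {R r} → R ⊆ X → r ∈ R → Balanced R →
                   ∃ λ v → v ∈ R - r × Adj G r v × Balanced (R - r - v)
  pair-universal {R} {r} R⊆X r∈R (2∣∣R∣ , _) with 0<∣p∣⇒nonempty {p = R - r} (n≢0⇒n>0 ∣R-r∣≢0)
    where
    ∣R-r∣≢0 : ∣ R - r ∣ ≢ 0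
    ∣R-r∣≢0 eq = >⇒∤ ≤-refl (subst (2 ∣_) (trans (∣p∣≡1+∣p-x∣ r∈R) (cong suc eq)) 2∣∣R∣)
  ... | v , v∈R-r =
    v , v∈R-r , X-adj (R⊆X r∈R) (proj₂ (x∈p-y⁻ {p = R} v∈R-r)) , 2∣∣p∣⇒2∣∣p-x-y∣ r∈R v∈R-r 2∣∣R∣ ,
    λ S⊆ J → p⊆q⇒∣p∣≤∣q∣ {q = (R - r - v) ∩ X}
               (λ s∈S → contradiction (R⊆X (proj₁ (x∈p-y-z⁻ (S⊆ s∈S)))) (non-universal J s∈S))

  NonUniversalEdge : Subset n → Set
  NonUniversalEdge R = ∃₂ λ u v → u ∈ R × v ∈ R - u × u ∉ X × v ∉ X × Adj G u v

  nonUniversalEdge? : ∀ R → Dec (NonUniversalEdge R)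
  nonUniversalEdge? R = any? (λ u → any? (λ v →
    (u ∈? R) ×-dec (v ∈? R - u) ×-dec ¬? (u ∈? X) ×-dec ¬? (v ∈? X) ×-dec T? (adj G u v)))

  ¬nonUniversalEdge⇒independent : ∀ {R} → ¬ NonUniversalEdge R → NonUniversalIndependent (R ∩ ∁ X)
  ¬nonUniversalEdge⇒independent {R} none = record
    { non-universal = outside-X
    ; independent   = λ {x} {y} x∈ y∈ xy → none
        (x , y , in-R x∈ , x∈p∧x≢y⇒x∈p-y (in-R y∈) (Adj-irrefl G xy ∘ sym) , outside-X x∈ , outside-X y∈ , xy)
    }
    where
    in-R : ∀ {x} → x ∈ R ∩ ∁ X → x ∈ R
    in-R = proj₁ ∘ x∈p∩q⁻ R _

    outside-X : ∀ {x} → x ∈ R ∩ ∁ X → x ∉ X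
    outside-X = x∈∁p⇒x∉p ∘ proj₂ ∘ x∈p∩q⁻ R _

  pairable : Pairable G Balanced
  pairable R balanced (r , r∈R) with nonUniversalEdge? R
  ... | yes (u , v , u∈R , v∈R-u , u∉X , v∉X , uv) =
        u , u∈R , v , v∈R-u , uv , pair-non-universal u∈R v∈R-u u∉X v∉X balanced
  ... | no none with any? (λ u → (u ∈? R) ×-dec ¬? (u ∈? X))
  ...   | yes (u , u∈R , u∉X) =
          u , u∈R , pair-with-universal (¬nonUniversalEdge⇒independent none) u∈R u∉X balanced
  ...   | no all-universal =
          r , r∈R , pair-universal R⊆X r∈R balanced
    where
    R⊆X : R ⊆ X
    R⊆X {x} x∈R = decidable-stable (x ∈? X) (λ x∉X → all-universal (x , x∈R , x∉X))

  perfectMatching-saturated : PerfectMatching G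
  perfectMatching-saturated = pairable⇒perfectMatching pairable balanced-⊤

lemma3p2 : (k n : ℕ) → 2 ≤ k → 2 ∣ n → (G : Graph n) → β≥1 k G → PerfectMatching G
lemma3p2 k n 2≤k 2∣n G =
  perfectMatching-by-saturation (λ {H} {H′} → β≥1-mono k {H} {H′})
                                (λ {H} → Saturated.perfectMatching-saturated {G = H} 2≤k 2∣n)
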